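{- Let $t\ge 2$ and $\lambda\ge 1$ be integers and let $D$ be a $(t,\lambda)$-liking digraph. If a vertex $v$ of $D$ satisfies $d^+(v)\le d^-(v)$, then \[0\le (d^+(v)-t-\lambda+1)(\lambda-t+1).\] Furthermore, if $d^+(v)<d^-(v)$, then $0<(d^+(v)-t-\lambda+1)(\lambda-t+1)$.
   Context: All digraphs are finite and have no loops and no multiple arcs. A digraph $D$ is a $(t,\lambda)$-liking digraph if every set of $t$ distinct vertices of $D$ has exactly $\lambda$ common out-neighbors (the definition presumes $D$ has at least $t$ vertices). $d^+(v)$ and $d^-(v)$ denote the out-degree and in-degree of $v$. -}

module Defs where

open import Data.Nat using (ℕ)
open import Data.Bool using (Bool; true; false; T; _∧_; _∨_; not)
open import Data.Fin using (Fin)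
open import Data.Fin.Subset using (Subset; ∣_∣)
open import Data.Vec using (lookup; count; tabulate; foldr′)
open import Relation.Binary.PropositionalEquality using (_≡_)
open import Data.Bool.Properties using (T?)

-- A finite digraph on vertex set Fin n, given by a Boolean adjacency
-- function: adj u w ≡ true iff there is an arc u → w.
-- No loops: adj v v ≡ false.  (No multiple arcs is automatic.)
record Digraph (n : ℕ) : Set where
  field
    adj    : Fin n → Fin n → Bool
    noLoop : ∀ v → adj v v ≡ false
open Digraph public

countTrue : ∀ {n} → (Fin n → Bool) → ℕ
countTrue f = count T? (tabulate f)

allFinB : ∀ {n} → (Fin n → Bool) → Bool
allFinB f = foldr′ _∧_ true (tabulate f)

outdeg : ∀ {n} → Digraph n → Fin n → ℕ
outdeg D v = countTrue (λ w → adj D v w)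

indeg : ∀ {n} → Digraph n → Fin n → ℕ
indeg D v = countTrue (λ u → adj D u v)

commonOut : ∀ {n} → Digraph n → Subset n → ℕ
commonOut D S = countTrue (λ w → allFinB (λ u → not (lookup S u) ∨ adj D u w))

record Liking {n : ℕ} (D : Digraph n) (t λ' : ℕ) : Set where
  field
    enough : t Data.Nat.≤ n
    liking : ∀ (S : Subset n) → ∣ S ∣ ≡ t → commonOut D S ≡ λ'

{-# OPTIONS --safe #-}
module Submission where

-- Write t = k + 1 and let N⁺(v), N⁻(v), of sizes d⁺ and d⁻, be the out- and in-neighbourhoods of v.
-- Two counting facts hold in every (t,λ)-liking digraph with λ ≥ 1.
--   k + λ ≤ d⁺: for a k-subset Q of N⁺(v), the λ common out-neighbours of {v} ∪ Q lie in N⁺(v) \ Q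
--   since there are no loops; and if d⁺ < k, a t-set containing {v} ∪ N⁺(v) has no common out-neighbour.
--   C(d⁻, k) ≤ C(d⁺, λ): J ↦ N⁺({v} ∪ J) maps the k-subsets of N⁻(v) injectively to λ-subsets of N⁺(v).
-- Writing d⁺ = k + λ + a, the product is a(λ − k); symmetry and unimodality of C(d⁺, ·), and the strict
-- growth of C(·, k) in the upper index, turn the second fact into the two sign conditions.

module Binomial where

  open import Data.Nat
  open import Data.Nat.Properties
  open import Data.Nat.Combinatorics using (_C_; nC1≡n; nCk≡nC[n∸k]; nCk+nC[k+1]≡[n+1]C[k+1])
  open import Data.Product using (_×_; _,_)
  open import Data.Sum using (_⊎_; inj₁; inj₂)
  open import Relation.Binary.PropositionalEquality
  open import Relation.Nullary using (yes; no; contradiction)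

  nCk>0 : ∀ {n k} → k ≤ n → n C k > 0
  nCk>0 {k = zero} _ = s≤s z≤n
  nCk>0 {suc n} {suc k} (s≤s k≤n) = begin-strict
    0                   <⟨ nCk>0 k≤n ⟩
    n C k               ≤⟨ m≤m+n _ _ ⟩
    n C k + n C suc k   ≡⟨ nCk+nC[k+1]≡[n+1]C[k+1] n k ⟩
    suc n C suc k       ∎
    where open ≤-Reasoning

  C-monoˡ-≤ : ∀ {n m} k → n ≤ m → n C k ≤ m C k
  C-monoˡ-≤ zero _ = ≤-refl
  C-monoˡ-≤ (suc k) z≤n = z≤n
  C-monoˡ-≤ {suc n} {suc m} (suc k) (s≤s n≤m) = begin
    suc n C suc k       ≡⟨ nCk+nC[k+1]≡[n+1]C[k+1] n k ⟨
    n C k + n C suc k   ≤⟨ +-mono-≤ (C-monoˡ-≤ k n≤m) (C-monoˡ-≤ (suc k) n≤m) ⟩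
    m C k + m C suc k   ≡⟨ nCk+nC[k+1]≡[n+1]C[k+1] m k ⟩
    suc m C suc k       ∎
    where open ≤-Reasoning

  C-monoˡ-< : ∀ {n m k} → suc k ≤ n → n < m → n C suc k < m C suc k
  C-monoˡ-< {n} {suc m} {k} k<n (s≤s n≤m) = begin-strict
    n C suc k           ≤⟨ C-monoˡ-≤ (suc k) n≤m ⟩
    m C suc k           <⟨ m<n+m _ (nCk>0 (≤-trans (n≤1+n k) (≤-trans k<n n≤m))) ⟩
    m C k + m C suc k   ≡⟨ nCk+nC[k+1]≡[n+1]C[k+1] m k ⟩
    suc m C suc k       ∎
    where open ≤-Reasoning

  [1+k]*[1+n]C[1+k]≡[1+n]*nCk : ∀ n k → suc k * (suc n C suc k) ≡ suc n * (n C k)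
  [1+k]*[1+n]C[1+k]≡[1+n]*nCk n zero =
    trans (*-identityˡ (suc n C 1)) (trans (nC1≡n (suc n)) (sym (*-identityʳ (suc n))))
  [1+k]*[1+n]C[1+k]≡[1+n]*nCk zero (suc k) = *-zeroʳ (suc (suc k))
  [1+k]*[1+n]C[1+k]≡[1+n]*nCk (suc n) (suc k) = begin
    suc (suc k) * (suc (suc n) C suc (suc k))
      ≡⟨ cong (suc (suc k) *_) (nCk+nC[k+1]≡[n+1]C[k+1] (suc n) (suc k)) ⟨
    suc (suc k) * (P + Q)
      ≡⟨ *-distribˡ-+ (suc (suc k)) P Q ⟩
    (P + suc k * P) + suc (suc k) * Q
      ≡⟨ cong₂ (λ x y → (P + x) + y) ([1+k]*[1+n]C[1+k]≡[1+n]*nCk n k) ([1+k]*[1+n]C[1+k]≡[1+n]*nCk n (suc k)) ⟩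
    (P + suc n * (n C k)) + suc n * (n C suc k)
      ≡⟨ +-assoc P _ _ ⟩
    P + (suc n * (n C k) + suc n * (n C suc k))
      ≡⟨ cong (P +_) (*-distribˡ-+ (suc n) (n C k) (n C suc k)) ⟨
    P + suc n * (n C k + n C suc k)
      ≡⟨ cong (λ x → P + suc n * x) (nCk+nC[k+1]≡[n+1]C[k+1] n k) ⟩
    P + suc n * P
      ∎
    where
    open ≡-Reasoning
    P = suc n C suc k
    Q = suc n C suc (suc k)

  -- (k+1)·C(n,k+1) = (n−k)·C(n,k) exceeds (k+1)·C(n,k); the chain adds (k+1)·C(n,k) to avoid subtraction.
  nCk<nC[k+1] : ∀ {n k} → suc k + suc k ≤ n → n C k < n C suc k
  nCk<nC[k+1] {n} {k} 2k+2≤n = *-cancelˡ-< (suc k) _ _ (+-cancelʳ-< (suc k * c) _ _ (begin-strict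
    suc k * c + suc k * c                 ≡⟨ *-distribʳ-+ c (suc k) (suc k) ⟨
    (suc k + suc k) * c                   ≤⟨ *-monoˡ-≤ c 2k+2≤n ⟩
    n * c                                 <⟨ m<n+m (n * c) c>0 ⟩
    suc n * c                             ≡⟨ [1+k]*[1+n]C[1+k]≡[1+n]*nCk n k ⟨
    suc k * (suc n C suc k)               ≡⟨ cong (suc k *_) (nCk+nC[k+1]≡[n+1]C[k+1] n k) ⟨
    suc k * (c + n C suc k)               ≡⟨ *-distribˡ-+ (suc k) c (n C suc k) ⟩
    suc k * c + suc k * (n C suc k)       ≡⟨ +-comm (suc k * c) _ ⟩
    suc k * (n C suc k) + suc k * c       ∎))
    where
    open ≤-Reasoning
    c = n C k
    c>0 : c > 0
    c>0 = nCk>0 (≤-trans (n≤1+n k) (≤-trans (m≤m+n (suc k) (suc k)) 2k+2≤n))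

  j<k≤n/2⇒nCj<nCk : ∀ {n j k} → j < k → k + k ≤ n → n C j < n C k
  j<k≤n/2⇒nCj<nCk {n} {j} {suc k} j<1+k 2k+2≤n with m<1+n⇒m<n∨m≡n j<1+k
  ... | inj₂ refl = nCk<nC[k+1] 2k+2≤n
  ... | inj₁ j<k  = <-trans (j<k≤n/2⇒nCj<nCk j<k (≤-trans (+-mono-≤ (n≤1+n k) (n≤1+n k)) 2k+2≤n))
                            (nCk<nC[k+1] 2k+2≤n)

  [m+n]Cm≡[m+n]Cn : ∀ m n → (m + n) C m ≡ (m + n) C n
  [m+n]Cm≡[m+n]Cn m n = trans (nCk≡nC[n∸k] (m≤m+n m n)) (cong ((m + n) C_) (m+n∸m≡n m n))

  j<k∧k+j<n⇒nCj<nCk : ∀ {n j k} → j < k → k + j < n → n C j < n C k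
  j<k∧k+j<n⇒nCj<nCk {n} {j} {k} j<k k+j<n with m≤n⇒∃[o]m+o≡n (≤-trans (m≤m+n k j) (<⇒≤ k+j<n))
  ... | r , refl with k ≤? r
  ...   | yes k≤r = j<k≤n/2⇒nCj<nCk j<k (+-monoʳ-≤ k k≤r)
  ...   | no k≰r  = begin-strict
    (k + r) C j  <⟨ j<k≤n/2⇒nCj<nCk (+-cancelˡ-< k j r k+j<n) (+-monoˡ-≤ r (<⇒≤ (≰⇒> k≰r))) ⟩
    (k + r) C r  ≡⟨ [m+n]Cm≡[m+n]Cn k r ⟨
    (k + r) C k  ∎
    where open ≤-Reasoning

  j≤k∧k+j≤n⇒nCj≤nCk : ∀ {n j k} → j ≤ k → k + j ≤ n → n C j ≤ n C k
  j≤k∧k+j≤n⇒nCj≤nCk {n} {j} {k} j≤k k+j≤n with m≤n⇒m<n∨m≡n j≤k | m≤n⇒m<n∨m≡n k+j≤n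
  ... | inj₂ refl | _         = ≤-refl
  ... | inj₁ j<k  | inj₁ k+j<n = <⇒≤ (j<k∧k+j<n⇒nCj<nCk j<k k+j<n)
  ... | inj₁ _    | inj₂ refl  = ≤-reflexive (sym ([m+n]Cm≡[m+n]Cn k j))

  eCk≤dCl∧d≤e⇒a≡0⊎k≤l : ∀ k l a {e} → e C k ≤ (k + l + a) C l → k + l + a ≤ e → a ≡ 0 ⊎ k ≤ l
  eCk≤dCl∧d≤e⇒a≡0⊎k≤l k l zero    _ _ = inj₁ refl
  eCk≤dCl∧d≤e⇒a≡0⊎k≤l k l (suc a) {e} eCk≤dCl d≤e with k ≤? l
  ... | yes k≤l = inj₂ k≤l
  ... | no  k≰l = contradiction eCk≤dCl (<⇒≱ (begin-strict
    d C l  <⟨ j<k∧k+j<n⇒nCj<nCk (≰⇒> k≰l) (m<m+n (k + l) z<s) ⟩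
    d C k  ≤⟨ C-monoˡ-≤ k d≤e ⟩
    e C k  ∎))
    where
    open ≤-Reasoning
    d = k + l + suc a

  [k+l+a]Cl≤[k+l+a]Ck : ∀ k l a → a ≡ 0 ⊎ l ≤ k → (k + l + a) C l ≤ (k + l + a) C k
  [k+l+a]Cl≤[k+l+a]Ck k l _ (inj₁ refl) rewrite +-identityʳ (k + l) = ≤-reflexive (sym ([m+n]Cm≡[m+n]Cn k l))
  [k+l+a]Cl≤[k+l+a]Ck k l a (inj₂ l≤k) = j≤k∧k+j≤n⇒nCj≤nCk l≤k (m≤m+n (k + l) a)

  [1+k+l+a]Cl<eC[1+k] : ∀ k l a {e} → a ≡ 0 ⊎ l ≤ suc k → suc k + l + a < e → (suc k + l + a) C l < e C suc k
  [1+k+l+a]Cl<eC[1+k] k l a h d<e = ≤-<-trans ([k+l+a]Cl≤[k+l+a]Ck (suc k) l a h)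
    (C-monoˡ-< (≤-trans (m≤m+n (suc k) l) (m≤m+n (suc k + l) a)) d<e)

  eCk≤dCl∧d<e⇒a>0×k<l : ∀ k l a {e} → e C suc k ≤ (suc k + l + a) C l → suc k + l + a < e → 0 < a × suc k < l
  eCk≤dCl∧d<e⇒a>0×k<l k l a eCk≤dCl d<e with a ≟ 0 | suc k <? l
  ... | no a≢0  | yes k<l = n≢0⇒n>0 a≢0 , k<l
  ... | yes a≡0 | _       = contradiction eCk≤dCl (<⇒≱ ([1+k+l+a]Cl<eC[1+k] k l a (inj₁ a≡0) d<e))
  ... | no _    | no k≮l  = contradiction eCk≤dCl (<⇒≱ ([1+k+l+a]Cl<eC[1+k] k l a (inj₂ (≮⇒≥ k≮l)) d<e))

module DegreeProduct where

  open Binomial using (eCk≤dCl∧d≤e⇒a≡0⊎k≤l; eCk≤dCl∧d<e⇒a>0×k<l)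
  open import Data.Nat
  open import Data.Nat.Properties using (m≤n⇒∃[o]m+o≡n; +-suc)
  open import Data.Nat.Combinatorics using (_C_)
  open import Data.Integer using (ℤ; +_; +≤+; +<+)
    renaming (_+_ to _+ℤ_; _-_ to _-ℤ_; _*_ to _*ℤ_; _≤_ to _≤ℤ_; _<_ to _<ℤ_)
  open import Data.Integer.Properties using (pos-+; pos-*)
  open import Data.Integer.Tactic.RingSolver using (solve-∀)
  open import Data.Product using (_×_; _,_)
  open import Data.Sum using (_⊎_; inj₁; inj₂)
  open import Relation.Binary.PropositionalEquality

  first-factor : ∀ k l a → + (k + l + a) -ℤ + suc k -ℤ + l +ℤ + 1 ≡ + a
  first-factor k l a = begin
    + (k + l + a) -ℤ + suc k -ℤ + l +ℤ + 1          ≡⟨ cong (λ x → x -ℤ + suc k -ℤ + l +ℤ + 1) +[k+l+a]≡ ⟩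
    + k +ℤ + l +ℤ + a -ℤ (+ 1 +ℤ + k) -ℤ + l +ℤ + 1  ≡⟨ ring (+ k) (+ l) (+ a) ⟩
    + a                                             ∎
    where
    open ≡-Reasoning
    +[k+l+a]≡ : + (k + l + a) ≡ + k +ℤ + l +ℤ + a
    +[k+l+a]≡ = trans (pos-+ (k + l) a) (cong (_+ℤ + a) (pos-+ k l))
    ring : ∀ (k l a : ℤ) → k +ℤ l +ℤ a -ℤ (+ 1 +ℤ k) -ℤ l +ℤ + 1 ≡ a
    ring = solve-∀

  second-factor : ∀ k b → + (k + b) -ℤ + suc k +ℤ + 1 ≡ + b
  second-factor k b = trans (cong (λ x → x -ℤ + suc k +ℤ + 1) (pos-+ k b)) (ring (+ k) (+ b))
    where
    ring : ∀ (k b : ℤ) → k +ℤ b -ℤ (+ 1 +ℤ k) +ℤ + 1 ≡ b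
    ring = solve-∀

  degreeProduct : ℕ → ℕ → ℕ → ℤ
  degreeProduct t l d = (+ d -ℤ + t -ℤ + l +ℤ + 1) *ℤ (+ l -ℤ + t +ℤ + 1)

  degreeProduct-excess : ∀ k l a → degreeProduct (suc k) l (k + l + a) ≡ + a *ℤ (+ l -ℤ + suc k +ℤ + 1)
  degreeProduct-excess k l a = cong (_*ℤ (+ l -ℤ + suc k +ℤ + 1)) (first-factor k l a)

  degreeProduct≡+[a*b] : ∀ k b a → degreeProduct (suc k) (k + b) (k + (k + b) + a) ≡ + (a * b)
  degreeProduct≡+[a*b] k b a = begin
    degreeProduct (suc k) (k + b) (k + (k + b) + a)  ≡⟨ degreeProduct-excess k (k + b) a ⟩
    + a *ℤ (+ (k + b) -ℤ + suc k +ℤ + 1)              ≡⟨ cong (+ a *ℤ_) (second-factor k b) ⟩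
    + a *ℤ + b                                       ≡⟨ pos-* a b ⟨
    + (a * b)                                        ∎
    where open ≡-Reasoning

  degreeProduct-nonneg : ∀ k l a → a ≡ 0 ⊎ k ≤ l → + 0 ≤ℤ degreeProduct (suc k) l (k + l + a)
  degreeProduct-nonneg k l _ (inj₁ refl) = subst (+ 0 ≤ℤ_) (sym (degreeProduct-excess k l 0)) (+≤+ z≤n)
  degreeProduct-nonneg k l a (inj₂ k≤l) with m≤n⇒∃[o]m+o≡n k≤l
  ... | b , refl = subst (+ 0 ≤ℤ_) (sym (degreeProduct≡+[a*b] k b a)) (+≤+ z≤n)

  degreeProduct-pos : ∀ k l a → 0 < a × k < l → + 0 <ℤ degreeProduct (suc k) l (k + l + a)
  degreeProduct-pos k l (suc a) (_ , k<l) with m≤n⇒∃[o]m+o≡n k<l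
  ... | o , refl = subst (λ l → + 0 <ℤ degreeProduct (suc k) l (k + l + suc a)) (+-suc k o)
    (subst (+ 0 <ℤ_) (sym (degreeProduct≡+[a*b] k (suc o) (suc a))) (+<+ z<s))

  degreeProduct-sign : ∀ r l d e → 1 ≤ r → r + l ≤ d → e C r ≤ d C l →
    (d ≤ e → + 0 ≤ℤ degreeProduct (suc r) l d) × (d < e → + 0 <ℤ degreeProduct (suc r) l d)
  degreeProduct-sign (suc k) l d e _ r+l≤d eCr≤dCl with m≤n⇒∃[o]m+o≡n r+l≤d
  ... | a , refl =
    (λ d≤e → degreeProduct-nonneg (suc k) l a (eCk≤dCl∧d≤e⇒a≡0⊎k≤l (suc k) l a eCr≤dCl d≤e)) ,
    (λ d<e → degreeProduct-pos (suc k) l a (eCk≤dCl∧d<e⇒a>0×k<l k l a eCr≤dCl d<e))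

module Subsets where

  open Binomial using (nCk>0)
  open import Data.Nat
  open import Data.Nat.Properties
  open import Data.Nat.Combinatorics using (_C_; nCk+nC[k+1]≡[n+1]C[k+1])
  open import Data.Empty using (⊥)
  open import Data.Fin using (Fin)
  open import Data.Fin.Subset using (Subset; _∈_; _∉_; _⊆_; _∪_; ⁅_⁆; ∁; ∣_∣; inside; outside)
  open import Data.Fin.Subset.Properties
    using (out⊆; in⊆in; drop-∷-⊆; x∈p∪q⁻; x∈⁅y⁆⇒x≡y; ∣⁅x⁆∣≡1; p⊆p∪q; x∈∁p⇒x∉p; ∣∁p∣≡n∸∣p∣)
  open import Data.List using (List; []; _∷_; [_]; _++_; map; length)
  open import Data.List.Properties using (length-map; length-++)
  open import Data.List.Membership.Propositional as List using ()
  open import Data.List.Membership.Propositional.Properties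
    using (∈-map⁺; ∈-map⁻; ∈-++⁺ˡ; ∈-++⁺ʳ; ∈-++⁻; ∈-∃++)
  open import Data.List.Relation.Unary.Any using (here; there)
  open import Data.List.Relation.Unary.All as All using ([])
  open import Data.List.Relation.Unary.AllPairs using ([]; _∷_)
  open import Data.List.Relation.Unary.Unique.Propositional using (Unique)
  import Data.List.Relation.Unary.Unique.Propositional.Properties as Unique
  open import Data.Product using (∃-syntax; _×_; _,_)
  open import Data.Sum using (inj₁; inj₂)
  open import Data.Vec using ([]; _∷_; here; there)
  open import Data.Vec.Properties using (∷-injectiveʳ)
  open import Relation.Binary.PropositionalEquality hiding ([_])
  open import Relation.Nullary using (contradiction)

  injectiveOn⇒length≤ : ∀ {A B : Set} (f : A → B) {xs : List A} {ys : List B} → Unique xs →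
    (∀ {x} → x List.∈ xs → f x List.∈ ys) →
    (∀ {x y} → x List.∈ xs → y List.∈ xs → f x ≡ f y → x ≡ y) →
    length xs ≤ length ys
  injectiveOn⇒length≤ f {[]} _ _ _ = z≤n
  injectiveOn⇒length≤ f {x ∷ xs} (x∉xs ∷ xs-unique) into inj with ∈-∃++ (into (here refl))
  ... | ys₁ , ys₂ , refl = begin
    suc (length xs)                  ≤⟨ s≤s (injectiveOn⇒length≤ f xs-unique into′ inj′) ⟩
    suc (length (ys₁ ++ ys₂))        ≡⟨ cong suc (length-++ ys₁) ⟩
    suc (length ys₁ + length ys₂)    ≡⟨ +-suc (length ys₁) (length ys₂) ⟨
    length ys₁ + length (f x ∷ ys₂)  ≡⟨ length-++ ys₁ ⟨
    length (ys₁ ++ f x ∷ ys₂)        ∎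
    where
    open ≤-Reasoning
    inj′ : ∀ {y z} → y List.∈ xs → z List.∈ xs → f y ≡ f z → y ≡ z
    inj′ y∈xs z∈xs = inj (there y∈xs) (there z∈xs)
    into′ : ∀ {y} → y List.∈ xs → f y List.∈ ys₁ ++ ys₂
    into′ y∈xs with ∈-++⁻ ys₁ (into (there y∈xs))
    ... | inj₁ p          = ∈-++⁺ˡ p
    ... | inj₂ (here eq)  = contradiction (sym (inj (there y∈xs) (here refl) eq)) (All.lookup x∉xs y∈xs)
    ... | inj₂ (there p)  = ∈-++⁺ʳ ys₁ p

  subsetsOfSize : ∀ {n} → Subset n → ℕ → List (Subset n)
  subsetsOfSize []             zero    = [ [] ]
  subsetsOfSize []             (suc k) = []
  subsetsOfSize (outside ∷ q)  k       = map (outside ∷_) (subsetsOfSize q k)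
  subsetsOfSize (inside ∷ q)   zero    = map (outside ∷_) (subsetsOfSize q zero)
  subsetsOfSize (inside ∷ q)   (suc k) =
    map (inside ∷_) (subsetsOfSize q k) ++ map (outside ∷_) (subsetsOfSize q (suc k))

  length-subsetsOfSize : ∀ {n} (q : Subset n) k → length (subsetsOfSize q k) ≡ ∣ q ∣ C k
  length-subsetsOfSize []            zero    = refl
  length-subsetsOfSize []            (suc k) = refl
  length-subsetsOfSize (outside ∷ q) k       =
    trans (length-map _ (subsetsOfSize q k)) (length-subsetsOfSize q k)
  length-subsetsOfSize (inside ∷ q)  zero    =
    trans (length-map _ (subsetsOfSize q zero)) (length-subsetsOfSize q zero)
  length-subsetsOfSize (inside ∷ q)  (suc k) = begin
    length (map (inside ∷_) (subsetsOfSize q k) ++ map (outside ∷_) (subsetsOfSize q (suc k)))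
      ≡⟨ length-++ (map (inside ∷_) (subsetsOfSize q k)) ⟩
    length (map (inside ∷_) (subsetsOfSize q k)) + length (map (outside ∷_) (subsetsOfSize q (suc k)))
      ≡⟨ cong₂ _+_ (length-map _ (subsetsOfSize q k)) (length-map _ (subsetsOfSize q (suc k))) ⟩
    length (subsetsOfSize q k) + length (subsetsOfSize q (suc k))
      ≡⟨ cong₂ _+_ (length-subsetsOfSize q k) (length-subsetsOfSize q (suc k)) ⟩
    ∣ q ∣ C k + ∣ q ∣ C suc k
      ≡⟨ nCk+nC[k+1]≡[n+1]C[k+1] ∣ q ∣ k ⟩
    suc ∣ q ∣ C suc k ∎
    where open ≡-Reasoning

  ∈-subsetsOfSize⁻ : ∀ {n} (q : Subset n) k {p} → p List.∈ subsetsOfSize q k → p ⊆ q × ∣ p ∣ ≡ k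
  ∈-subsetsOfSize⁻ []            zero    (here refl) = (λ ()) , refl
  ∈-subsetsOfSize⁻ (outside ∷ q) k       p∈ with ∈-map⁻ _ p∈
  ... | _ , p∈′ , refl with ∈-subsetsOfSize⁻ q k p∈′
  ...   | p⊆q , ∣p∣≡k = out⊆ p⊆q , ∣p∣≡k
  ∈-subsetsOfSize⁻ (inside ∷ q)  zero    p∈ with ∈-map⁻ _ p∈
  ... | _ , p∈′ , refl with ∈-subsetsOfSize⁻ q zero p∈′
  ...   | p⊆q , ∣p∣≡0 = out⊆ p⊆q , ∣p∣≡0
  ∈-subsetsOfSize⁻ (inside ∷ q)  (suc k) p∈ with ∈-++⁻ (map (inside ∷_) (subsetsOfSize q k)) p∈
  ... | inj₁ p∈ᵢ with ∈-map⁻ _ p∈ᵢ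
  ...   | _ , p∈′ , refl with ∈-subsetsOfSize⁻ q k p∈′
  ...     | p⊆q , ∣p∣≡k = in⊆in p⊆q , cong suc ∣p∣≡k
  ∈-subsetsOfSize⁻ (inside ∷ q)  (suc k) p∈ | inj₂ p∈ₒ with ∈-map⁻ _ p∈ₒ
  ...   | _ , p∈′ , refl with ∈-subsetsOfSize⁻ q (suc k) p∈′
  ...     | p⊆q , ∣p∣≡k = out⊆ p⊆q , ∣p∣≡k

  ∈-subsetsOfSize⁺ : ∀ {n} {q p : Subset n} {k} → p ⊆ q → ∣ p ∣ ≡ k → p List.∈ subsetsOfSize q k
  ∈-subsetsOfSize⁺ {q = []}          {[]}           {zero}  _   _ = here refl
  ∈-subsetsOfSize⁺ {q = outside ∷ q} {inside ∷ p}           p⊆q _ with p⊆q here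
  ... | ()
  ∈-subsetsOfSize⁺ {q = outside ∷ q} {outside ∷ p}          p⊆q ∣p∣≡k =
    ∈-map⁺ _ (∈-subsetsOfSize⁺ (drop-∷-⊆ p⊆q) ∣p∣≡k)
  ∈-subsetsOfSize⁺ {q = inside ∷ q}  {inside ∷ p}  {suc k}  p⊆q ∣p∣≡k =
    ∈-++⁺ˡ (∈-map⁺ _ (∈-subsetsOfSize⁺ (drop-∷-⊆ p⊆q) (suc-injective ∣p∣≡k)))
  ∈-subsetsOfSize⁺ {q = inside ∷ q}  {outside ∷ p} {zero}   p⊆q ∣p∣≡k =
    ∈-map⁺ _ (∈-subsetsOfSize⁺ (drop-∷-⊆ p⊆q) ∣p∣≡k)
  ∈-subsetsOfSize⁺ {q = inside ∷ q}  {outside ∷ p} {suc k}  p⊆q ∣p∣≡k =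
    ∈-++⁺ʳ (map (inside ∷_) (subsetsOfSize q k)) (∈-map⁺ _ (∈-subsetsOfSize⁺ (drop-∷-⊆ p⊆q) ∣p∣≡k))

  subsetsOfSize-unique : ∀ {n} (q : Subset n) k → Unique (subsetsOfSize q k)
  subsetsOfSize-unique []            zero    = [] ∷ []
  subsetsOfSize-unique []            (suc k) = []
  subsetsOfSize-unique (outside ∷ q) k       = Unique.map⁺ ∷-injectiveʳ (subsetsOfSize-unique q k)
  subsetsOfSize-unique (inside ∷ q)  zero    = Unique.map⁺ ∷-injectiveʳ (subsetsOfSize-unique q zero)
  subsetsOfSize-unique (inside ∷ q)  (suc k) = Unique.++⁺
    (Unique.map⁺ ∷-injectiveʳ (subsetsOfSize-unique q k))
    (Unique.map⁺ ∷-injectiveʳ (subsetsOfSize-unique q (suc k)))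
    λ (p∈ᵢ , p∈ₒ) → heads-differ (∈-map⁻ _ p∈ᵢ) (∈-map⁻ _ p∈ₒ)
    where
    heads-differ : ∀ {p : Subset (suc _)} {xs ys} →
      ∃[ x ] (x List.∈ xs × p ≡ inside ∷ x) → ∃[ y ] (y List.∈ ys × p ≡ outside ∷ y) → ⊥
    heads-differ (_ , _ , p≡i∷x) (_ , _ , p≡o∷y) with trans (sym p≡i∷x) p≡o∷y
    ... | ()

  ∃-subsetOfSize : ∀ {n} (q : Subset n) {k} → k ≤ ∣ q ∣ → ∃[ p ] (p ⊆ q × ∣ p ∣ ≡ k)
  ∃-subsetOfSize q {k} k≤∣q∣ with subsetsOfSize q k | length-subsetsOfSize q k | ∈-subsetsOfSize⁻ q k
  ... | []    | 0≡qCk | _     = contradiction 0≡qCk (<⇒≢ (nCk>0 k≤∣q∣))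
  ... | p ∷ _ | _     | sound = p , sound (here refl)

  disjoint⇒∣p∪q∣≡∣p∣+∣q∣ : ∀ {n} (p q : Subset n) → (∀ {x} → x ∈ p → x ∉ q) → ∣ p ∪ q ∣ ≡ ∣ p ∣ + ∣ q ∣
  disjoint⇒∣p∪q∣≡∣p∣+∣q∣ []            []            _        = refl
  disjoint⇒∣p∪q∣≡∣p∣+∣q∣ (inside ∷ p)  (inside ∷ q)  disjoint = contradiction here (disjoint here)
  disjoint⇒∣p∪q∣≡∣p∣+∣q∣ (inside ∷ p)  (outside ∷ q) disjoint =
    cong suc (disjoint⇒∣p∪q∣≡∣p∣+∣q∣ p q (λ x∈p x∈q → disjoint (there x∈p) (there x∈q)))
  disjoint⇒∣p∪q∣≡∣p∣+∣q∣ (outside ∷ p) (inside ∷ q)  disjoint = trans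
    (cong suc (disjoint⇒∣p∪q∣≡∣p∣+∣q∣ p q (λ x∈p x∈q → disjoint (there x∈p) (there x∈q))))
    (sym (+-suc ∣ p ∣ ∣ q ∣))
  disjoint⇒∣p∪q∣≡∣p∣+∣q∣ (outside ∷ p) (outside ∷ q) disjoint =
    disjoint⇒∣p∪q∣≡∣p∣+∣q∣ p q (λ x∈p x∈q → disjoint (there x∈p) (there x∈q))

  x∉p⇒∣⁅x⁆∪p∣≡1+∣p∣ : ∀ {n} {x : Fin n} {p} → x ∉ p → ∣ ⁅ x ⁆ ∪ p ∣ ≡ suc ∣ p ∣
  x∉p⇒∣⁅x⁆∪p∣≡1+∣p∣ {x = x} {p} x∉p = trans
    (disjoint⇒∣p∪q∣≡∣p∣+∣q∣ ⁅ x ⁆ p (λ y∈⁅x⁆ y∈p → x∉p (subst (_∈ p) (x∈⁅y⁆⇒x≡y x y∈⁅x⁆) y∈p)))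
    (cong (_+ ∣ p ∣) (∣⁅x⁆∣≡1 x))

  ∃-supersetOfSize : ∀ {n} (p : Subset n) {k} → ∣ p ∣ ≤ k → k ≤ n → ∃[ s ] (p ⊆ s × ∣ s ∣ ≡ k)
  ∃-supersetOfSize p {k} ∣p∣≤k k≤n
    with ∃-subsetOfSize (∁ p) {k ∸ ∣ p ∣} (subst (k ∸ ∣ p ∣ ≤_) (sym (∣∁p∣≡n∸∣p∣ p)) (∸-monoˡ-≤ ∣ p ∣ k≤n))
  ... | r , r⊆∁p , ∣r∣≡k-∣p∣ = p ∪ r , p⊆p∪q r , (begin
    ∣ p ∪ r ∣          ≡⟨ disjoint⇒∣p∪q∣≡∣p∣+∣q∣ p r (λ x∈p x∈r → x∈∁p⇒x∉p (r⊆∁p x∈r) x∈p) ⟩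
    ∣ p ∣ + ∣ r ∣      ≡⟨ cong (∣ p ∣ +_) ∣r∣≡k-∣p∣ ⟩
    ∣ p ∣ + (k ∸ ∣ p ∣) ≡⟨ m+[n∸m]≡n ∣p∣≤k ⟩
    k                  ∎)
    where open ≡-Reasoning

  ∪-least : ∀ {n} {p q r : Subset n} → p ⊆ r → q ⊆ r → p ∪ q ⊆ r
  ∪-least {p = p} {q} p⊆r q⊆r x∈ with x∈p∪q⁻ p q x∈
  ... | inj₁ x∈p = p⊆r x∈p
  ... | inj₂ x∈q = q⊆r x∈q

  x∈p⇒⁅x⁆⊆p : ∀ {n} {x : Fin n} {p} → x ∈ p → ⁅ x ⁆ ⊆ p
  x∈p⇒⁅x⁆⊆p {x = x} {p} x∈p y∈⁅x⁆ = subst (_∈ p) (sym (x∈⁅y⁆⇒x≡y x y∈⁅x⁆)) x∈p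

module LikingDigraphs where

  open Subsets
  open import Defs
  open import Data.Nat
  open import Data.Nat.Properties
  open import Data.Nat.Combinatorics using (_C_)
  open import Data.Bool using (Bool; true; false; not; _∨_)
  open import Data.Bool.Properties using (T?)
  open import Data.Fin using (Fin; zero; suc)
  open import Data.Fin.Subset using (Subset; _∈_; _∉_; _⊆_; _∪_; ⁅_⁆; ⊥; ∣_∣)
  open import Data.Fin.Subset.Properties
    using (_∈?_; ⊆-antisym; p⊆q⇒∣p∣≤∣q∣; p⊆p∪q; q⊆p∪q; x∈p∪q⁻; x∈⁅x⁆; x∈⁅y⁆⇒x≡y; ∣⊥∣≡0)
  open import Data.Vec using (Vec; []; _∷_; lookup; tabulate; count)
  open import Data.Vec.Properties using ([]=⇒lookup; lookup⇒[]=; lookup∘tabulate)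
  open import Data.List.Membership.Propositional as List using ()
  open import Data.Product using (_,_)
  open import Data.Sum using (inj₁; inj₂)
  open import Relation.Binary.PropositionalEquality
  open import Relation.Nullary using (yes; no; contradiction)

  count-T?≡∣_∣ : ∀ {n} (xs : Vec Bool n) → count T? xs ≡ ∣ xs ∣
  count-T?≡∣ []         ∣ = refl
  count-T?≡∣ true  ∷ xs ∣ = cong suc count-T?≡∣ xs ∣
  count-T?≡∣ false ∷ xs ∣ = count-T?≡∣ xs ∣

  ∈-tabulate⁻ : ∀ {n} (f : Fin n → Bool) {x} → x ∈ tabulate f → f x ≡ true
  ∈-tabulate⁻ f {x} x∈ = trans (sym (lookup∘tabulate f x)) ([]=⇒lookup x∈)

  ∈-tabulate⁺ : ∀ {n} (f : Fin n → Bool) {x} → f x ≡ true → x ∈ tabulate f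
  ∈-tabulate⁺ f {x} fx≡true = lookup⇒[]= x (tabulate f) (trans (lookup∘tabulate f x) fx≡true)

  allFinB⁻ : ∀ {n} (f : Fin n → Bool) → allFinB f ≡ true → ∀ i → f i ≡ true
  allFinB⁻ f all≡true zero    with f zero | all≡true
  ... | true | _ = refl
  allFinB⁻ f all≡true (suc i) with f zero | all≡true
  ... | true | rest≡true = allFinB⁻ (λ j → f (suc j)) rest≡true i

  allFinB⁺ : ∀ {n} (f : Fin n → Bool) → (∀ i → f i ≡ true) → allFinB f ≡ true
  allFinB⁺ {zero}  f _    = refl
  allFinB⁺ {suc n} f f≡true rewrite f≡true zero = allFinB⁺ (λ j → f (suc j)) (λ j → f≡true (suc j))

  module _ {n} (D : Digraph n) where

    N⁺ N⁻ : Fin n → Subset n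
    N⁺ v = tabulate (λ w → adj D v w)
    N⁻ v = tabulate (λ u → adj D u v)

    commonN⁺ : Subset n → Subset n
    commonN⁺ S = tabulate (λ w → allFinB (λ u → not (lookup S u) ∨ adj D u w))

    outdeg≡∣N⁺∣ : ∀ v → outdeg D v ≡ ∣ N⁺ v ∣
    outdeg≡∣N⁺∣ v = count-T?≡∣ N⁺ v ∣

    indeg≡∣N⁻∣ : ∀ v → indeg D v ≡ ∣ N⁻ v ∣
    indeg≡∣N⁻∣ v = count-T?≡∣ N⁻ v ∣

    commonOut≡∣commonN⁺∣ : ∀ S → commonOut D S ≡ ∣ commonN⁺ S ∣
    commonOut≡∣commonN⁺∣ S = count-T?≡∣ commonN⁺ S ∣

    ∈-commonN⁺⁻ : ∀ {S u w} → w ∈ commonN⁺ S → u ∈ S → adj D u w ≡ true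
    ∈-commonN⁺⁻ {S} {u} {w} w∈ u∈S = subst (λ b → not b ∨ adj D u w ≡ true) ([]=⇒lookup u∈S)
      (allFinB⁻ _ (∈-tabulate⁻ _ w∈) u)

    ∈-commonN⁺⁺ : ∀ S {w} → (∀ {u} → u ∈ S → adj D u w ≡ true) → w ∈ commonN⁺ S
    ∈-commonN⁺⁺ S {w} arcs = ∈-tabulate⁺ _ (allFinB⁺ _ arc-or-outside)
      where
      arc-or-outside : ∀ u → not (lookup S u) ∨ adj D u w ≡ true
      arc-or-outside u with lookup S u in u∈S
      ... | true  = arcs (lookup⇒[]= u S u∈S)
      ... | false = refl

    no-arc-to-self : ∀ {x} → adj D x x ≢ true
    no-arc-to-self {x} x→x with trans (sym x→x) (noLoop D x)
    ... | ()

    commonN⁺-disjoint : ∀ {S x} → x ∈ commonN⁺ S → x ∉ S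
    commonN⁺-disjoint x∈ x∈S = no-arc-to-self (∈-commonN⁺⁻ x∈ x∈S)

    commonN⁺⊆N⁺ : ∀ {S v} → v ∈ S → commonN⁺ S ⊆ N⁺ v
    commonN⁺⊆N⁺ v∈S x∈ = ∈-tabulate⁺ _ (∈-commonN⁺⁻ x∈ v∈S)

    ⊆N⁻⇒∈commonN⁺ : ∀ S {v} → S ⊆ N⁻ v → v ∈ commonN⁺ S
    ⊆N⁻⇒∈commonN⁺ S S⊆N⁻v = ∈-commonN⁺⁺ S (λ u∈S → ∈-tabulate⁻ _ (S⊆N⁻v u∈S))

    v∉N⁺v : ∀ {v} → v ∉ N⁺ v
    v∉N⁺v v∈ = no-arc-to-self (∈-tabulate⁻ _ v∈)

    v∉N⁻v : ∀ {v} → v ∉ N⁻ v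
    v∉N⁻v v∈ = no-arc-to-self (∈-tabulate⁻ _ v∈)

  module _ {n} {D : Digraph n} {k lam} (L : Liking D (suc k) lam) where

    ∣commonN⁺∣≡λ : ∀ S → ∣ S ∣ ≡ suc k → ∣ commonN⁺ D S ∣ ≡ lam
    ∣commonN⁺∣≡λ S ∣S∣≡t = trans (sym (commonOut≡∣commonN⁺∣ D S)) (Liking.liking L S ∣S∣≡t)

    ⊆commonN⁺⇒∣∣≤λ : ∀ S {X} → ∣ S ∣ ≡ suc k → X ⊆ commonN⁺ D S → ∣ X ∣ ≤ lam
    ⊆commonN⁺⇒∣∣≤λ S {X} ∣S∣≡t X⊆ = subst (∣ X ∣ ≤_) (∣commonN⁺∣≡λ S ∣S∣≡t) (p⊆q⇒∣p∣≤∣q∣ X⊆)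

    k+λ≤∣N⁺∣ : 1 ≤ lam → ∀ v → k + lam ≤ ∣ N⁺ D v ∣
    k+λ≤∣N⁺∣ λ≥1 v with k ≤? ∣ N⁺ D v ∣
    ... | yes k≤d with ∃-subsetOfSize (N⁺ D v) k≤d
    ...   | Q , Q⊆N⁺v , ∣Q∣≡k = begin
      k + lam                 ≡⟨ cong₂ _+_ (sym ∣Q∣≡k) (sym (∣commonN⁺∣≡λ S ∣S∣≡t)) ⟩
      ∣ Q ∣ + ∣ commonN⁺ D S ∣  ≡⟨ disjoint⇒∣p∪q∣≡∣p∣+∣q∣ Q _ (λ x∈Q x∈ → commonN⁺-disjoint D x∈ (Q⊆S x∈Q)) ⟨
      ∣ Q ∪ commonN⁺ D S ∣      ≤⟨ p⊆q⇒∣p∣≤∣q∣ (∪-least Q⊆N⁺v (commonN⁺⊆N⁺ D (p⊆p∪q Q (x∈⁅x⁆ v)))) ⟩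
      ∣ N⁺ D v ∣               ∎
      where
      open ≤-Reasoning
      S = ⁅ v ⁆ ∪ Q
      Q⊆S : Q ⊆ S
      Q⊆S = q⊆p∪q ⁅ v ⁆ Q
      ∣S∣≡t : ∣ S ∣ ≡ suc k
      ∣S∣≡t = trans (x∉p⇒∣⁅x⁆∪p∣≡1+∣p∣ (λ v∈Q → v∉N⁺v D (Q⊆N⁺v v∈Q))) (cong suc ∣Q∣≡k)
    k+λ≤∣N⁺∣ λ≥1 v | no k≰d with ∃-supersetOfSize (⁅ v ⁆ ∪ N⁺ D v)
      (subst (_≤ suc k) (sym (x∉p⇒∣⁅x⁆∪p∣≡1+∣p∣ (v∉N⁺v D))) (s≤s (<⇒≤ (≰⇒> k≰d)))) (Liking.enough L)
    ... | S , v∪N⁺v⊆S , ∣S∣≡t = contradiction λ≤0 (<⇒≱ λ≥1)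
      where
      commonN⁺⊆N⁺v : commonN⁺ D S ⊆ N⁺ D v
      commonN⁺⊆N⁺v = commonN⁺⊆N⁺ D (v∪N⁺v⊆S (p⊆p∪q (N⁺ D v) (x∈⁅x⁆ v)))
      commonN⁺-empty : commonN⁺ D S ⊆ ⊥
      commonN⁺-empty x∈ = contradiction (v∪N⁺v⊆S (q⊆p∪q ⁅ v ⁆ _ (commonN⁺⊆N⁺v x∈))) (commonN⁺-disjoint D x∈)
      λ≤0 : lam ≤ 0
      λ≤0 = begin
        lam               ≡⟨ ∣commonN⁺∣≡λ S ∣S∣≡t ⟨
        ∣ commonN⁺ D S ∣  ≤⟨ p⊆q⇒∣p∣≤∣q∣ commonN⁺-empty ⟩
        ∣ ⊥ {n} ∣          ≡⟨ ∣⊥∣≡0 n ⟩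
        0                 ∎
        where open ≤-Reasoning

    ∣⁅v⁆∪J∣≡t : ∀ {v J} → J ⊆ N⁻ D v → ∣ J ∣ ≡ k → ∣ ⁅ v ⁆ ∪ J ∣ ≡ suc k
    ∣⁅v⁆∪J∣≡t J⊆N⁻v ∣J∣≡k = trans (x∉p⇒∣⁅x⁆∪p∣≡1+∣p∣ (λ v∈J → v∉N⁻v D (J⊆N⁻v v∈J))) (cong suc ∣J∣≡k)

    -- Otherwise the t-set {u} ∪ J would have the λ + 1 common out-neighbours {v} ∪ N⁺({v} ∪ J).
    commonN⁺[v∪J]⊆N⁺u⇒u∈J : ∀ {v J u} → J ⊆ N⁻ D v → ∣ J ∣ ≡ k → u ∈ N⁻ D v →
      commonN⁺ D (⁅ v ⁆ ∪ J) ⊆ N⁺ D u → u ∈ J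
    commonN⁺[v∪J]⊆N⁺u⇒u∈J {v} {J} {u} J⊆N⁻v ∣J∣≡k u∈N⁻v common⊆N⁺u with u ∈? J
    ... | yes u∈J = u∈J
    ... | no  u∉J =
      contradiction (⊆commonN⁺⇒∣∣≤λ T ∣T∣≡t v∪common⊆) (subst (_≰ lam) (sym ∣v∪common∣≡1+λ) (n≮n lam))
      where
      T = ⁅ u ⁆ ∪ J
      ∣T∣≡t : ∣ T ∣ ≡ suc k
      ∣T∣≡t = trans (x∉p⇒∣⁅x⁆∪p∣≡1+∣p∣ u∉J) (cong suc ∣J∣≡k)
      v∪common⊆ : ⁅ v ⁆ ∪ commonN⁺ D (⁅ v ⁆ ∪ J) ⊆ commonN⁺ D T
      v∪common⊆ = ∪-least (x∈p⇒⁅x⁆⊆p (⊆N⁻⇒∈commonN⁺ D T (∪-least (x∈p⇒⁅x⁆⊆p u∈N⁻v) J⊆N⁻v)))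
                          (λ x∈common → ∈-commonN⁺⁺ D T (T→x x∈common))
        where
        T→x : ∀ {x t} → x ∈ commonN⁺ D (⁅ v ⁆ ∪ J) → t ∈ T → adj D t x ≡ true
        T→x {x} x∈common t∈T with x∈p∪q⁻ ⁅ u ⁆ J t∈T
        ... | inj₁ t∈⁅u⁆ = subst (λ t → adj D t x ≡ true) (sym (x∈⁅y⁆⇒x≡y u t∈⁅u⁆))
                                 (∈-tabulate⁻ _ (common⊆N⁺u x∈common))
        ... | inj₂ t∈J   = ∈-commonN⁺⁻ D x∈common (q⊆p∪q ⁅ v ⁆ J t∈J)
      ∣v∪common∣≡1+λ : ∣ ⁅ v ⁆ ∪ commonN⁺ D (⁅ v ⁆ ∪ J) ∣ ≡ suc lam
      ∣v∪common∣≡1+λ = trans (x∉p⇒∣⁅x⁆∪p∣≡1+∣p∣ (λ v∈ → v∉N⁺v D (commonN⁺⊆N⁺ D (p⊆p∪q J (x∈⁅x⁆ v)) v∈)))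
                             (cong suc (∣commonN⁺∣≡λ (⁅ v ⁆ ∪ J) (∣⁅v⁆∪J∣≡t J⊆N⁻v ∣J∣≡k)))

    ∣N⁻∣Ck≤∣N⁺∣Cλ : ∀ v → ∣ N⁻ D v ∣ C k ≤ ∣ N⁺ D v ∣ C lam
    ∣N⁻∣Ck≤∣N⁺∣Cλ v = subst₂ _≤_ (length-subsetsOfSize (N⁻ D v) k) (length-subsetsOfSize (N⁺ D v) lam)
      (injectiveOn⇒length≤ f (subsetsOfSize-unique (N⁻ D v) k) f-into f-injective)
      where
      f : Subset n → Subset n
      f J = commonN⁺ D (⁅ v ⁆ ∪ J)

      f-into : ∀ {J} → J List.∈ subsetsOfSize (N⁻ D v) k → f J List.∈ subsetsOfSize (N⁺ D v) lam
      f-into {J} J∈ with ∈-subsetsOfSize⁻ (N⁻ D v) k J∈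
      ... | J⊆N⁻v , ∣J∣≡k = ∈-subsetsOfSize⁺ (commonN⁺⊆N⁺ D (p⊆p∪q J (x∈⁅x⁆ v)))
                                            (∣commonN⁺∣≡λ (⁅ v ⁆ ∪ J) (∣⁅v⁆∪J∣≡t J⊆N⁻v ∣J∣≡k))

      f≡⇒⊇ : ∀ {J J′} → J List.∈ subsetsOfSize (N⁻ D v) k → J′ List.∈ subsetsOfSize (N⁻ D v) k →
        f J ≡ f J′ → J′ ⊆ J
      f≡⇒⊇ {J} {J′} J∈ J′∈ fJ≡fJ′ {u} u∈J′
        with ∈-subsetsOfSize⁻ (N⁻ D v) k J∈ | ∈-subsetsOfSize⁻ (N⁻ D v) k J′∈
      ... | J⊆N⁻v , ∣J∣≡k | J′⊆N⁻v , _ = commonN⁺[v∪J]⊆N⁺u⇒u∈J J⊆N⁻v ∣J∣≡k (J′⊆N⁻v u∈J′)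
        (λ {x} x∈fJ → ∈-tabulate⁺ _ (∈-commonN⁺⁻ D (subst (x ∈_) fJ≡fJ′ x∈fJ) (q⊆p∪q ⁅ v ⁆ J′ u∈J′)))

      f-injective : ∀ {J J′} → J List.∈ subsetsOfSize (N⁻ D v) k → J′ List.∈ subsetsOfSize (N⁻ D v) k →
        f J ≡ f J′ → J ≡ J′
      f-injective J∈ J′∈ fJ≡fJ′ = ⊆-antisym (f≡⇒⊇ J′∈ J∈ (sym fJ≡fJ′)) (f≡⇒⊇ J∈ J′∈ fJ≡fJ′)

    k+λ≤outdeg : 1 ≤ lam → ∀ v → k + lam ≤ outdeg D v
    k+λ≤outdeg λ≥1 v rewrite outdeg≡∣N⁺∣ D v = k+λ≤∣N⁺∣ λ≥1 v

    indegCk≤outdegCλ : ∀ v → indeg D v C k ≤ outdeg D v C lam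
    indegCk≤outdegCλ v rewrite indeg≡∣N⁻∣ D v | outdeg≡∣N⁺∣ D v = ∣N⁻∣Ck≤∣N⁺∣Cλ v

open import Defs
open import Data.Nat using (ℕ; _≤_; _<_; suc; s≤s)
open import Data.Fin using (Fin)
open import Data.Integer using (+_; _-_; _*_; _+_) renaming (_≤_ to _≤ℤ_; _<_ to _<ℤ_)
open import Data.Product using (_×_)
open LikingDigraphs using (k+λ≤outdeg; indegCk≤outdegCλ)
open DegreeProduct using (degreeProduct-sign)

lemma3p1 : (t lam n : ℕ) → 2 ≤ t → 1 ≤ lam → (D : Digraph n) → Liking D t lam → (v : Fin n)
    → (outdeg D v ≤ indeg D v → + 0 ≤ℤ ((+ outdeg D v - + t - + lam + + 1) * (+ lam - + t + + 1)))
    × (outdeg D v < indeg D v → + 0 <ℤ ((+ outdeg D v - + t - + lam + + 1) * (+ lam - + t + + 1)))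
lemma3p1 (suc k) lam n (s≤s 1≤k) λ≥1 D L v =
  degreeProduct-sign k lam (outdeg D v) (indeg D v) 1≤k (k+λ≤outdeg L λ≥1 v) (indegCk≤outdegCλ L v)
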